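{- Let $X$ be a set. The interpretation functor $I\colon\mathbb G^{sr}_X\to r\mathcal G_{\underline\Pi_X}$ defined below is dense, full and faithful.
   Context: For a set $Y$, $\underline\Pi_X(Y)$ is the quotient of $Y^X$ by the action of $\mathrm{Aut}(X)$ permuting coordinates; this gives a functor $\underline\Pi_X$, and $\eta_Y\colon Y\to\underline\Pi_X(Y)$, $y\mapsto[(y)_{x\in X}]$ (class of the constant tuple), is natural. Reflexive $\underline\Pi_X$-graphs: the category $r\mathcal G_{\underline\Pi_X}$ has objects $G=(G(P),G(V),\partial_G)$ where $G(P)$ is a set, $G(V)\subseteq G(P)$ and $\partial_G\colon G(P)\to\underline\Pi_X(G(V))$ is a map whose restriction to $G(V)$ is $\eta_{G(V)}$; a morphism $f\colon G\to H$ is a map $f_P\colon G(P)\to H(P)$ sending $G(V)$ into $H(V)$ such that $\partial_H\circ f_P=\underline\Pi_X(f_V)\circ\partial_G$, where $f_V$ is the restriction of $f_P$ to $G(V)$. The theory $\mathbb G^{sr}_X$: the category with objects $V,A$, $\mathrm{Hom}(V,A)=X$, $\mathrm{Hom}(A,V)=\{\ell\}$, $\mathrm{Hom}(V,V)=\{\mathrm{id}\}$, $\mathrm{Hom}(A,A)=\mathrm{Aut}(X)\cup\{c_y:y\in X\}$ (permutations and constant maps of $X$), where the composite of $x\colon V\to A$ followed by $m\colon A\to A$ is $m(x)$, composition of endomorphisms of $A$ is composition of maps, $\ell\circ m=\ell$, $\ell\circ x=\mathrm{id}_V$, and the composite $A\xrightarrow{\ell}V\xrightarrow{y}A$ is $c_y$.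 The interpretation: $I(V)$ has $P=V=1$; $I(A)$ has $P=X\sqcup\{\top\}$, $V=X$, $\partial=\eta_X$ on $X$ and $\partial(\top)=[(x)_{x\in X}]$. On morphisms: $I(x)$ is the map $1\to X\sqcup\{\top\}$ picking $x$; $I(\sigma)$ for $\sigma\in\mathrm{Aut}(X)$ acts by $\sigma$ on $X$ and fixes $\top$; $I(c_y)$ sends every part to $y$; $I(\ell)$ is the map to the one-point graph. $I$ is dense if every object $G$ of $r\mathcal G_{\underline\Pi_X}$ is the colimit of the canonical diagram $I\downarrow G\to r\mathcal G_{\underline\Pi_X}$, $(c,\varphi)\mapsto I(c)$. -}

module Defs where

open import Data.Empty using (⊥)
open import Data.Unit using (⊤; tt)
open import Data.Sum using (_⊎_; inj₁; inj₂)
open import Data.Product using (Σ; ∃; _,_; _×_)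
open import Function using (_∘_; id; _↔_; Inverse)
open import Relation.Binary.PropositionalEquality using (_≡_; refl; cong; trans)

-- Aut(X) and the functor Π_X on sets (as a setoid: no quotients here)

Aut : Set → Set
Aut X = X ↔ X

perm : {X : Set} → Aut X → X → X
perm σ = Inverse.to σ

-- Two tuples t, s ∈ Y^X represent the same element of Π_X(Y) = Y^X / Aut(X)
-- iff they differ by a permutation of coordinates.
_≈Π_ : {X Y : Set} → (X → Y) → (X → Y) → Set
_≈Π_ {X} t s = Σ (Aut X) λ σ → ∀ x → t (perm σ x) ≡ s x

η : {X Y : Set} → Y → (X → Y)
η y = λ _ → y

-- Reflexive Π_X-graphs.  The subset G(V) ⊆ G(P) is given as an injection ι.

record RGraph (X : Set) : Set₁ where
  field
    P     : Set
    V     : Set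
    ι     : V → P
    ι-inj : ∀ {v w} → ι v ≡ ι w → v ≡ w
    ∂     : P → (X → V)               -- ∂ : G(P) → Π_X(G(V)) (a representative)
    ∂-η   : ∀ v → ∂ (ι v) ≈Π η v

open RGraph public

record Hom {X : Set} (G H : RGraph X) : Set where
  field
    fP    : P G → P H
    fV    : V G → V H
    fP-ι  : ∀ v → fP (ι G v) ≡ ι H (fV v)
    fP-∂  : ∀ p → ∂ H (fP p) ≈Π (fV ∘ ∂ G p)

open Hom public

_≈H_ : {X : Set} {G H : RGraph X} → Hom G H → Hom G H → Set
f ≈H g = ∀ p → fP f p ≡ fP g p

_∘H_ : {X : Set} {G H K : RGraph X} → Hom H K → Hom G H → Hom G K
_∘H_ {X} {G} {H} {K} g f = record
  { fP = fP g ∘ fP f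
  ; fV = fV g ∘ fV f
  ; fP-ι = λ v → trans (cong (fP g) (fP-ι f v)) (fP-ι g (fV f v))
  ; fP-∂ = λ p → comp p (fP-∂ f p) (fP-∂ g (fP f p))
  }
  where
  comp : ∀ p → ∂ H (fP f p) ≈Π (fV f ∘ ∂ G p)
             → ∂ K (fP g (fP f p)) ≈Π (fV g ∘ ∂ H (fP f p))
             → ∂ K (fP g (fP f p)) ≈Π (fV g ∘ fV f ∘ ∂ G p)
  comp p (σ , eσ) (τ , eτ) =
    Function.Construct.Composition._↔-∘_ τ σ ,
    λ x → trans (eτ (perm σ x)) (cong (fV g) (eσ x))
    where import Function.Construct.Composition

data Ob : Set where
  oV oA : Ob

GHom : (X : Set) → Ob → Ob → Set
GHom X oV oV = ⊤
GHom X oV oA = X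
GHom X oA oV = ⊤          -- {ℓ}
GHom X oA oA = Aut X ⊎ X  -- inj₁ σ = permutation σ, inj₂ y = constant map c_y

GEq : (X : Set) (c d : Ob) → GHom X c d → GHom X c d → Set
GEq X oV oV _ _ = ⊤
GEq X oV oA x y = x ≡ y
GEq X oA oV _ _ = ⊤
GEq X oA oA (inj₁ σ) (inj₁ τ) = ∀ x → perm σ x ≡ perm τ x
GEq X oA oA (inj₁ σ) (inj₂ y) = ⊥
GEq X oA oA (inj₂ y) (inj₁ τ) = ⊥
GEq X oA oA (inj₂ y) (inj₂ z) = y ≡ z

I₀ : (X : Set) → Ob → RGraph X
I₀ X oV = record
  { P = ⊤ ; V = ⊤ ; ι = id ; ι-inj = λ e → e ; ∂ = λ _ _ → tt
  ; ∂-η = λ v → Function.Construct.Identity.↔-id X , λ _ → refl }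
  where import Function.Construct.Identity
I₀ X oA = record
  { P = X ⊎ ⊤ ; V = X ; ι = inj₁ ; ι-inj = inj₁-inj ; ∂ = bd
  ; ∂-η = λ v → Function.Construct.Identity.↔-id X , λ _ → refl }
  where
  import Function.Construct.Identity
  inj₁-inj : ∀ {v w : X} → _≡_ {A = X ⊎ ⊤} (inj₁ v) (inj₁ w) → v ≡ w
  inj₁-inj refl = refl
  bd : X ⊎ ⊤ → X → X
  bd (inj₁ x) = λ _ → x
  bd (inj₂ _) = λ x → x

private
  idAut : (X : Set) → Aut X
  idAut X = Function.Construct.Identity.↔-id X
    where import Function.Construct.Identity

I₁ : (X : Set) (c d : Ob) → GHom X c d → Hom (I₀ X c) (I₀ X d)
I₁ X oV oV _ = record
  { fP = id ; fV = id ; fP-ι = λ _ → refl ; fP-∂ = λ _ → idAut X , λ _ → refl }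
I₁ X oV oA x = record
  { fP = λ _ → inj₁ x ; fV = λ _ → x ; fP-ι = λ _ → refl
  ; fP-∂ = λ _ → idAut X , λ _ → refl }
I₁ X oA oV _ = record
  { fP = λ _ → tt ; fV = λ _ → tt ; fP-ι = λ _ → refl
  ; fP-∂ = λ _ → idAut X , λ _ → refl }
I₁ X oA oA (inj₁ σ) = record
  { fP = act ; fV = perm σ ; fP-ι = λ _ → refl ; fP-∂ = bd }
  where
  act : X ⊎ ⊤ → X ⊎ ⊤
  act (inj₁ x) = inj₁ (perm σ x)
  act (inj₂ t) = inj₂ t
  bd : ∀ p → ∂ (I₀ X oA) (act p) ≈Π (perm σ ∘ ∂ (I₀ X oA) p)
  bd (inj₁ x) = idAut X , λ _ → refl
  bd (inj₂ t) = σ , λ _ → refl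
I₁ X oA oA (inj₂ y) = record
  { fP = λ _ → inj₁ y ; fV = λ _ → y ; fP-ι = λ _ → refl
  ; fP-∂ = λ _ → idAut X , λ _ → refl }

Faithful : (X : Set) → Set
Faithful X = ∀ c d (u v : GHom X c d) → I₁ X c d u ≈H I₁ X c d v → GEq X c d u v

Full : (X : Set) → Set
Full X = ∀ c d (f : Hom (I₀ X c) (I₀ X d)) → ∃ λ u → I₁ X c d u ≈H f

-- A cocone over the canonical diagram I ↓ G → rG_{Π_X}, (c, φ) ↦ I(c), with vertex H:
-- a family ψ_(c,φ) : I(c) → H compatible with every arrow u : (c,φ) → (d,φ')
-- of I ↓ G (i.e. u : c → d with φ' ∘ I(u) = φ).
Cocone : {X : Set} (G H : RGraph X) → Set
Cocone {X} G H =
  Σ ((c : Ob) → Hom (I₀ X c) G → Hom (I₀ X c) H) λ ψ →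
    ∀ c d (φ : Hom (I₀ X c) G) (φ' : Hom (I₀ X d) G) (u : GHom X c d) →
      (φ' ∘H I₁ X c d u) ≈H φ → (ψ d φ' ∘H I₁ X c d u) ≈H ψ c φ

-- G is the colimit of the canonical diagram, with the canonical cocone (c, φ) ↦ φ
IsCanonicalColimit : {X : Set} → RGraph X → Set₁
IsCanonicalColimit {X} G =
  ∀ (H : RGraph X) (κ : Cocone G H) →
    let ψ = Data.Product.proj₁ κ in
    Σ (Hom G H) λ h →
      (∀ c (φ : Hom (I₀ X c) G) → (h ∘H φ) ≈H ψ c φ) ×
      (∀ (h' : Hom G H) → (∀ c (φ : Hom (I₀ X c) G) → (h' ∘H φ) ≈H ψ c φ) → h' ≈H h)
  where import Data.Product

Dense : (X : Set) → Set₁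
Dense X = ∀ (G : RGraph X) → IsCanonicalColimit G

module Submission where

-- The proof rests on the observation that the two objects I(V) and I(A)
-- represent the vertices and the parts of a reflexive Π_X-graph G: a vertex
-- v gives a morphism  vertexMap v : I(V) → G  and a part p gives a morphism
-- partMap p : I(A) → G  sending ⊤ to p and x to the x-th boundary vertex of
-- p.  Every morphism out of I(V) or I(A) is of this form, up to precomposing
-- with a permutation I(σ) (classification lemmas), and restricting partMap p
-- along I(x) resp. vertexMap v along I(ℓ) gives vertexMap (∂ p x) resp.
-- partMap (ι v).
--
-- Faithfulness is read off by evaluating at the parts of I(A).  Fullness on
-- End(I(A)) follows from the classification of morphisms I(A) → I(A):
-- partMap q ∘ I(σ) is I(σ) when q = ⊤ and the constant c_y when q = y.
-- Density: a cocone ψ over I ↓ G induces h : G → H with  h(p) = ψ_{partMap p}(⊤),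
-- the naturality of ψ along I(x), I(ℓ) and I(σ) shows h is a morphism
-- factoring ψ, and uniqueness holds because h' ∘ partMap p takes ⊤ to h'(p).

open import Defs
open import Data.Product using (_×_; _,_; proj₁; proj₂)
open import Data.Sum using (_⊎_; inj₁; inj₂)
open import Data.Unit using (⊤; tt)
open import Data.Empty using (⊥)
open import Function using (_∘_; Inverse)
open import Relation.Binary.PropositionalEquality
open import Function.Construct.Identity using (↔-id)

inj₁-injective : {A B : Set} {a b : A} → _≡_ {A = A ⊎ B} (inj₁ a) (inj₁ b) → a ≡ b
inj₁-injective refl = refl

inj₁≢inj₂ : {A B : Set} {a : A} {b : B} → _≡_ {A = A ⊎ B} (inj₁ a) (inj₂ b) → ⊥
inj₁≢inj₂ ()

module _ {X : Set} where

  top : P (I₀ X oA)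
  top = inj₂ tt

  -- In a reflexive graph every boundary coordinate of a vertex is that vertex:
  -- ∂(ι v) is only known to be a permutation of the constant tuple.
  ∂-vertex : (G : RGraph X) (v : V G) (x : X) → ∂ G (ι G v) x ≡ v
  ∂-vertex G v x =
    let (σ , e) = ∂-η G v in
    trans (cong (∂ G (ι G v)) (sym (Inverse.strictlyInverseˡ σ x)))
          (e (Inverse.from σ x))

  module Representables (G : RGraph X) where

    vertexMap : V G → Hom (I₀ X oV) G
    vertexMap v = record
      { fP = λ _ → ι G v ; fV = λ _ → v ; fP-ι = λ _ → refl ; fP-∂ = λ _ → ∂-η G v }

    partMap : P G → Hom (I₀ X oA) G
    partMap p = record
      { fP = onParts ; fV = ∂ G p ; fP-ι = λ _ → refl ; fP-∂ = onBoundary }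
      where
      onParts : P (I₀ X oA) → P G
      onParts (inj₁ x) = ι G (∂ G p x)
      onParts (inj₂ _) = p

      onBoundary : ∀ q → ∂ G (onParts q) ≈Π (∂ G p ∘ ∂ (I₀ X oA) q)
      onBoundary (inj₁ x) = ∂-η G (∂ G p x)
      onBoundary (inj₂ _) = ↔-id X , λ _ → refl

    partMap-face : ∀ p x → (partMap p ∘H I₁ X oV oA x) ≈H vertexMap (∂ G p x)
    partMap-face p x _ = refl

    restrict-along-ℓ : (φ : Hom (I₀ X oV) G) →
                       (φ ∘H I₁ X oA oV tt) ≈H partMap (fP φ tt)
    restrict-along-ℓ φ (inj₂ _) = refl
    restrict-along-ℓ φ (inj₁ x) = begin
      fP φ tt                          ≡⟨ fP-ι φ tt ⟩
      ι G (fV φ tt)                    ≡⟨ cong (ι G) (sym (∂-vertex G (fV φ tt) x)) ⟩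
      ι G (∂ G (ι G (fV φ tt)) x)      ≡⟨ cong (λ q → ι G (∂ G q x)) (sym (fP-ι φ tt)) ⟩
      ι G (∂ G (fP φ tt) x)            ∎
      where open ≡-Reasoning

    boundaryPerm : Hom (I₀ X oA) G → Aut X
    boundaryPerm φ = proj₁ (fP-∂ φ top)

    partMap-classifies : (φ : Hom (I₀ X oA) G) →
      (partMap (fP φ top) ∘H I₁ X oA oA (inj₁ (boundaryPerm φ))) ≈H φ
    partMap-classifies φ (inj₁ x) =
      trans (cong (ι G) (proj₂ (fP-∂ φ top) x)) (sym (fP-ι φ x))
    partMap-classifies φ (inj₂ _) = refl

  open Representables public

  endoOf : P (I₀ X oA) → Aut X → GHom X oA oA
  endoOf (inj₁ y) σ = inj₂ y
  endoOf (inj₂ _) σ = inj₁ σ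

  -- I(endoOf q σ) is partMap q ∘ I(σ): the identity of I(A) is partMap ⊤
  -- and partMap y is constant at y.
  I-endoOf : ∀ q σ →
    I₁ X oA oA (endoOf q σ) ≈H (partMap (I₀ X oA) q ∘H I₁ X oA oA (inj₁ σ))
  I-endoOf (inj₁ y) σ (inj₁ x) = refl
  I-endoOf (inj₁ y) σ (inj₂ _) = refl
  I-endoOf (inj₂ _) σ (inj₁ x) = refl
  I-endoOf (inj₂ _) σ (inj₂ _) = refl

faithful : (X : Set) → Faithful X
faithful X oV oV u v eq = tt
faithful X oV oA u v eq = inj₁-injective (eq tt)
faithful X oA oV u v eq = tt
faithful X oA oA (inj₁ σ) (inj₁ τ) eq x = inj₁-injective (eq (inj₁ x))
faithful X oA oA (inj₁ σ) (inj₂ y) eq = inj₁≢inj₂ (sym (eq top))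
faithful X oA oA (inj₂ y) (inj₁ τ) eq = inj₁≢inj₂ (eq top)
faithful X oA oA (inj₂ y) (inj₂ z) eq = inj₁-injective (eq top)

full : (X : Set) → Full X
full X oV oV f = tt , λ _ → refl
full X oV oA f = fV f tt , λ _ → sym (fP-ι f tt)
full X oA oV f = tt , λ _ → refl
full X oA oA f =
  endoOf (fP f top) σ , λ q → trans (I-endoOf (fP f top) σ q) (partMap-classifies _ f q)
  where σ = boundaryPerm (I₀ X oA) f

module Induced {X : Set} (G H : RGraph X) (κ : Cocone G H) where

  ψ : (c : Ob) → Hom (I₀ X c) G → Hom (I₀ X c) H
  ψ = proj₁ κ

  natural : ∀ c d (φ : Hom (I₀ X c) G) (φ' : Hom (I₀ X d) G) (u : GHom X c d) →
            (φ' ∘H I₁ X c d u) ≈H φ → (ψ d φ' ∘H I₁ X c d u) ≈H ψ c φ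
  natural = proj₂ κ

  hP : P G → P H
  hP p = fP (ψ oA (partMap G p)) top

  hV : V G → V H
  hV v = fV (ψ oV (vertexMap G v)) tt

  -- h ∘ φ = ψ_φ for φ out of I(V), by naturality along I(ℓ).
  factors-V : (φ : Hom (I₀ X oV) G) → ∀ t → hP (fP φ t) ≡ fP (ψ oV φ) t
  factors-V φ tt =
    sym (natural oA oV (partMap G (fP φ tt)) φ tt (restrict-along-ℓ G φ) top)

  hP-ι : ∀ v → hP (ι G v) ≡ ι H (hV v)
  hP-ι v = trans (factors-V (vertexMap G v) tt) (fP-ι (ψ oV (vertexMap G v)) tt)

  -- The vertices of ψ_{partMap p} are the images under h of the boundary of p,
  -- by naturality along I(x).
  boundary-vertices : ∀ p x → fV (ψ oA (partMap G p)) x ≡ hV (∂ G p x)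
  boundary-vertices p x = ι-inj H (begin
    ι H (fV (ψ oA (partMap G p)) x)         ≡⟨ sym (fP-ι (ψ oA (partMap G p)) x) ⟩
    fP (ψ oA (partMap G p)) (inj₁ x)        ≡⟨ natural oV oA _ _ x (partMap-face G p x) tt ⟩
    fP (ψ oV (vertexMap G (∂ G p x))) tt    ≡⟨ fP-ι (ψ oV (vertexMap G (∂ G p x))) tt ⟩
    ι H (hV (∂ G p x))                       ∎)
    where open ≡-Reasoning

  hP-∂ : ∀ p → ∂ H (hP p) ≈Π (hV ∘ ∂ G p)
  hP-∂ p = let (σ , e) = fP-∂ (ψ oA (partMap G p)) top in
           σ , λ x → trans (e x) (boundary-vertices p x)

  h : Hom G H
  h = record { fP = hP ; fV = hV ; fP-ι = hP-ι ; fP-∂ = hP-∂ }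

  -- h factors the cocone: on ⊤ by naturality along I(σ) (classification of φ),
  -- on a vertex x by reduction to the case of I(V) through I(x).
  factors : ∀ c (φ : Hom (I₀ X c) G) → (h ∘H φ) ≈H ψ c φ
  factors oV φ = factors-V φ
  factors oA φ (inj₂ tt) =
    natural oA oA φ (partMap G (fP φ top)) (inj₁ (boundaryPerm G φ))
            (partMap-classifies G φ) top
  factors oA φ (inj₁ x) =
    trans (factors-V (φ ∘H I₁ X oV oA x) tt)
          (sym (natural oV oA (φ ∘H I₁ X oV oA x) φ x (λ _ → refl) tt))

  -- Any factorisation h' agrees with h, since h' ∘ partMap p sends ⊤ to h'(p).
  unique : (h' : Hom G H) → (∀ c (φ : Hom (I₀ X c) G) → (h' ∘H φ) ≈H ψ c φ) → h' ≈H h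
  unique h' h'-factors p = h'-factors oA (partMap G p) top

dense : (X : Set) → Dense X
dense X G H κ = h , factors , unique
  where open Induced G H κ

lemma5p9 : (X : Set) → Dense X × Full X × Faithful X
lemma5p9 X = dense X , full X , faithful X
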